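{- Let $(i_2,\ldots,i_n)$ be a dominant sequence of weight $N\ge2$. If $p_1,\ldots,p_N\in\mathbb{N}$ satisfy $1\le p_1<\cdots<p_N\le 2i_2+3i_3+\cdots+ni_n-2$, then $P_{i_2,\ldots,i_n}(p_1,\ldots,p_N)=0$.
   Context: Sequences here are indexed starting at $2$: a sequence $(i_2,\ldots,i_n)\in\mathbb{N}^{n-1}$ is dominant if $i_n\ne0$. For a nonzero sequence $(i_2,\ldots,i_n)$, its dominant $\partial(i_2,\ldots,i_n)=(i_2,\ldots,i_m)$ with $m=\max\{j: i_j\ne0\}$ (i.e. trailing zeros removed). The weight is $\omega(i_2,\ldots,i_n)=1i_2+2i_3+\cdots+(n-1)i_n-1$; note $\omega\circ\partial=\omega$. The dominant sequences of weight $1$ are $(2)$ and $(0,1)$. For each dominant sequence $(i_2,\ldots,i_n)$ of weight $\omega\ge1$ define a polynomial $P_{i_2,\ldots,i_n}\in\mathbb{Z}[X_1,\ldots,X_\omega]$ by: $P_{2}=(X_1-2)(X_1-1)$, $P_{0,1}=X_1-1$, and, if $\omega=\omega(i_2,\ldots,i_n)\ge2$, \[P_{i_2,\ldots,i_n}=\sum_{3\le j\le n,\ i_j\ge1}(i_{j-1}+1)P_{\partial(i_2,\ldots,i_{j-2},i_{j-1}+1,i_j-1,i_{j+1},\ldots,i_n)}+\delta_{i_2\ge1}\,(X_\omega-2i_2-3i_3-\cdots-ni_n+2)\,P_{\partial(i_2-1,i_3,\ldots,i_n)},\] where $\delta_{i_2\ge1}$ is $1$ if $i_2\ge1$ and $0$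 otherwise; the sequences on the right have weight $\omega-1$, and their polynomials (in $X_1,\ldots,X_{\omega-1}$) are viewed in $\mathbb{Z}[X_1,\ldots,X_\omega]$. -}

module Defs where

open import Data.Nat as ℕ using (ℕ; zero; suc; _∸_; _≤ᵇ_)
open import Data.Integer as ℤ using (ℤ; +_; _-_)
open import Data.List using (List; []; _∷_; map; last)
open import Data.Maybe using (just)
open import Data.Product using (_×_; _,_; ∃)
open import Data.Bool using (if_then_else_)

-- Sequences (i_2, …, i_n) are lists [i_2, …, i_n] (head = i_2).

Dominant : List ℕ → Set
Dominant s = ∃ λ a → last s ≡′ just (suc a)
  where open import Relation.Binary.PropositionalEquality renaming (_≡_ to _≡′_)

-- ∂ : remove trailing zeros
∂ : List ℕ → List ℕ
∂ [] = []
∂ (x ∷ xs) with ∂ xs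
... | [] = if x ℕ.≡ᵇ 0 then [] else (x ∷ [])
... | y ∷ ys = x ∷ y ∷ ys

wsum : ℕ → List ℕ → ℕ
wsum c [] = 0
wsum c (a ∷ s) = c ℕ.* a ℕ.+ wsum (suc c) s

weight : List ℕ → ℕ
weight s = wsum 1 s ∸ 1

bigS : List ℕ → ℕ
bigS s = wsum 2 s

-- for each j ≥ 3 with i_j ≥ 1: the pair
-- ( i_{j-1}+1 , (i_2,…,i_{j-1}+1, i_j-1, …, i_n) )   (∂ applied later)
moves : List ℕ → List (ℕ × List ℕ)
moves [] = []
moves (a ∷ []) = []
moves (a ∷ zero ∷ rest) = map (λ { (c , t) → (c , a ∷ t) }) (moves (zero ∷ rest))
moves (a ∷ suc b ∷ rest) =
  (suc a , suc a ∷ b ∷ rest) ∷ map (λ { (c , t) → (c , a ∷ t) }) (moves (suc b ∷ rest))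

sumℤ : List ℤ → ℤ
sumℤ [] = ℤ.0ℤ
sumℤ (x ∷ xs) = x ℤ.+ sumℤ xs

-- δ-term: δ_{i_2 ≥ 1} (X_ω - S + 2) · P_{∂(i_2-1, i_3, …, i_n)}, given the
-- evaluation map rec of polynomials of weight ω-1
δterm : ℕ → (List ℕ → ℤ) → (ℕ → ℤ) → List ℕ → ℤ
δterm ω rec x (suc a ∷ rest) = (x ω - + bigS (suc a ∷ rest) ℤ.+ + 2) ℤ.* rec (∂ (a ∷ rest))
δterm ω rec x _ = ℤ.0ℤ

-- Polynomials are represented by their evaluation maps: an assignment
-- x : ℕ → ℤ gives X_k ↦ x k (k ≥ 1).  Pf k s x is the value of P_s at x,
-- computed with fuel k, which is always the weight of s when used.
-- weight 1: P_2 = (X_1 - 2)(X_1 - 1), P_{0,1} = X_1 - 1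
Pbase : List ℕ → (ℕ → ℤ) → ℤ
Pbase (2 ∷ []) x = (x 1 - + 2) ℤ.* (x 1 - + 1)
Pbase (0 ∷ 1 ∷ []) x = x 1 - + 1
Pbase s x = ℤ.0ℤ

-- Pstep k rec: given rec = evaluation map for weight k sequences,
-- evaluate P_s for s of weight k+1 (the defining recursion)
Pstep : ℕ → (List ℕ → (ℕ → ℤ) → ℤ) → List ℕ → (ℕ → ℤ) → ℤ
Pstep zero rec s x = Pbase s x
Pstep (suc k) rec s x =
  sumℤ (map (λ { (c , t) → + c ℤ.* rec (∂ t) x }) (moves s))
  ℤ.+ δterm (suc (suc k)) (λ t → rec t x) x s

Pf : ℕ → List ℕ → (ℕ → ℤ) → ℤ
Pf zero s x = ℤ.0ℤ
Pf (suc k) s x = Pstep k (Pf k) s x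

P : List ℕ → (ℕ → ℤ) → ℤ
P s x = Pf (weight s) s x

{-# OPTIONS --safe #-}
module Submission where

-- By induction on the weight, with the bound  p_ω + 2 ≤ S(s)  as invariant.
-- A move (i_{j-1}, i_j) ↦ (i_{j-1} + 1, i_j - 1) lowers S by 1 and the δ-term
-- lowers it by 2, while p_{ω-1} ≤ p_ω - 1; so every polynomial of weight ω - 1
-- on the right-hand side of the recursion still satisfies the invariant and
-- vanishes, except in the δ-term when S(s) = p_ω + 2, where the factor
-- X_ω - S(s) + 2 vanishes instead.  In weight 1 the roots of
-- P_2 = (X_1 - 2)(X_1 - 1) and P_{0,1} = X_1 - 1 are exactly the admissible p_1.

open import Defs
open import Data.Nat using (ℕ; suc; _≤_; _<_; _+_)
open import Data.Integer using (+_; 0ℤ)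
open import Data.List using (List)
open import Relation.Binary.PropositionalEquality using (_≡_)

open import Data.Nat using (zero; z≤n; s≤s; s≤s⁻¹; _*_; _≡ᵇ_)
open import Data.Nat.Properties
  using (≤-trans; ≤-refl; +-comm; +-suc; *-zeroʳ; ≡ᵇ⇒≡; m<n⇒m<1+n; m≤n⇒m<n∨m≡n; +-cancelʳ-≤; +-cancelʳ-<)
open import Data.Nat.Tactic.RingSolver using (solve-∀)
open import Data.Integer as ℤ using (ℤ)
open import Data.Integer.Properties as ℤ using (pos-+)
import Data.Integer.Tactic.RingSolver as ℤ-Solver
open import Data.List using ([]; _∷_; map)
open import Data.List.Relation.Unary.All as All using (All; []; _∷_)
open import Data.List.Relation.Unary.All.Properties using (map⁺)
open import Data.Product using (proj₁; proj₂)
open import Data.Sum using (inj₁; inj₂)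
open import Data.Bool using (true; false)
open import Relation.Binary.PropositionalEquality using (refl; sym; trans; cong; cong₂; subst)

wsum-∂ : ∀ c s → wsum c (∂ s) ≡ wsum c s
wsum-∂ c [] = refl
wsum-∂ c (x ∷ xs) with ∂ xs | wsum-∂ (suc c) xs
... | y ∷ ys | e = cong (λ w → c * x + w) e
... | [] | e with x ≡ᵇ 0 | ≡ᵇ⇒≡ x 0
...   | false | _ = cong (λ w → c * x + w) e
...   | true | x≡0 rewrite x≡0 _ | *-zeroʳ c = e

wsum-suc-head : ∀ d a r → wsum d (suc a ∷ r) ≡ wsum d (a ∷ r) + d
wsum-suc-head d a r = ring d a (wsum (suc d) r)
  where
  ring : ∀ d a w → d * suc a + w ≡ d * a + w + d
  ring = solve-∀

OneBelow : List ℕ → List ℕ → Set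
OneBelow t s = ∀ d → suc (wsum d t) ≡ wsum d s

OneBelow-∷ : ∀ a {t s} → OneBelow t s → OneBelow (a ∷ t) (a ∷ s)
OneBelow-∷ a t⋖s d = trans (sym (+-suc (d * a) _)) (cong (λ w → d * a + w) (t⋖s (suc d)))

OneBelow-move : ∀ a b r → OneBelow (suc a ∷ b ∷ r) (a ∷ suc b ∷ r)
OneBelow-move a b r d = ring d a b (wsum (suc (suc d)) r)
  where
  ring : ∀ d a b w → suc (d * suc a + (suc d * b + w)) ≡ d * a + (suc d * suc b + w)
  ring = solve-∀

wsum-moves : ∀ s → All (λ m → OneBelow (proj₂ m) s) (moves s)
wsum-moves [] = []
wsum-moves (a ∷ []) = []
wsum-moves (a ∷ zero ∷ r) =
  map⁺ (All.map (λ {m} → OneBelow-∷ a {proj₂ m} {zero ∷ r}) (wsum-moves (zero ∷ r)))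
wsum-moves (a ∷ suc b ∷ r) =
  OneBelow-move a b r ∷ map⁺ (All.map (λ {m} → OneBelow-∷ a {proj₂ m} {suc b ∷ r}) (wsum-moves (suc b ∷ r)))

sumℤ-zero : ∀ {zs} → All (_≡ 0ℤ) zs → sumℤ zs ≡ 0ℤ
sumℤ-zero [] = refl
sumℤ-zero (refl ∷ zs≡0) = trans (ℤ.+-identityˡ _) (sumℤ-zero zs≡0)

*-zeroʳ-≡ : ∀ a {b} → b ≡ 0ℤ → a ℤ.* b ≡ 0ℤ
*-zeroʳ-≡ a refl = ℤ.*-zeroʳ a

n-[n+2]+2≡0 : ∀ n → + n ℤ.- + (n + 2) ℤ.+ + 2 ≡ 0ℤ
n-[n+2]+2≡0 n rewrite pos-+ n 2 = ring (+ n)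
  where
  ring : ∀ a → a ℤ.- (a ℤ.+ + 2) ℤ.+ + 2 ≡ 0ℤ
  ring = ℤ-Solver.solve-∀

X-1-root : ∀ {n} → 1 ≤ n → n ≤ 1 → + n ℤ.- + 1 ≡ 0ℤ
X-1-root (s≤s z≤n) (s≤s z≤n) = refl

[X-2][X-1]-root : ∀ {n} → 1 ≤ n → n ≤ 2 → (+ n ℤ.- + 2) ℤ.* (+ n ℤ.- + 1) ≡ 0ℤ
[X-2][X-1]-root (s≤s z≤n) (s≤s z≤n) = refl
[X-2][X-1]-root (s≤s z≤n) (s≤s (s≤s z≤n)) = refl

<-<⇒+2≤ : ∀ {l m n} → l < m → m < n → l + 2 ≤ n
<-<⇒+2≤ {l} {n = n} l<m m<n = subst (_≤ n) (+-comm 2 l) (≤-trans (s≤s l<m) m<n)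

+2≤suc⇒< : ∀ {m n} → m + 2 ≤ suc n → m < n
+2≤suc⇒< {m} {n} m+2≤1+n = s≤s⁻¹ (subst (_≤ suc n) (+-comm m 2) m+2≤1+n)

module _ (p : ℕ → ℕ) where

  private
    x : ℕ → ℤ
    x k = + p k

  Pbase-vanishes : 1 ≤ p 1 → ∀ s → p 1 + 2 ≤ bigS s → Pbase s x ≡ 0ℤ
  Pbase-vanishes 1≤p₁ (2 ∷ []) hS = [X-2][X-1]-root 1≤p₁ (+-cancelʳ-≤ 2 _ 2 hS)
  Pbase-vanishes 1≤p₁ (0 ∷ 1 ∷ []) hS = X-1-root 1≤p₁ (+-cancelʳ-≤ 2 _ 1 hS)
  Pbase-vanishes _ [] _ = refl
  Pbase-vanishes _ (0 ∷ []) _ = refl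
  Pbase-vanishes _ (0 ∷ 0 ∷ _) _ = refl
  Pbase-vanishes _ (0 ∷ 1 ∷ _ ∷ _) _ = refl
  Pbase-vanishes _ (0 ∷ suc (suc _) ∷ _) _ = refl
  Pbase-vanishes _ (1 ∷ _) _ = refl
  Pbase-vanishes _ (2 ∷ _ ∷ _) _ = refl
  Pbase-vanishes _ (suc (suc (suc _)) ∷ _) _ = refl

  δterm-vanishes : ∀ ω {rec : List ℕ → ℤ} → (∀ t → p ω < bigS t → rec t ≡ 0ℤ) →
                   ∀ s → p ω + 2 ≤ bigS s → δterm ω rec x s ≡ 0ℤ
  δterm-vanishes ω rec-0 [] _ = refl
  δterm-vanishes ω rec-0 (zero ∷ r) _ = refl
  δterm-vanishes ω rec-0 (suc a ∷ r) hS with m≤n⇒m<n∨m≡n hS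
  ... | inj₂ S≡p+2 = cong (ℤ._* _) (subst (λ S → x ω ℤ.- + S ℤ.+ + 2 ≡ 0ℤ) S≡p+2 (n-[n+2]+2≡0 (p ω)))
  ... | inj₁ p+2<S = *-zeroʳ-≡ (x ω ℤ.- + bigS (suc a ∷ r) ℤ.+ + 2) (rec-0 (∂ (a ∷ r)) p<S′)
    where
    p<S′ : p ω < bigS (∂ (a ∷ r))
    p<S′ rewrite wsum-∂ 2 (a ∷ r) = +-cancelʳ-< 2 _ _ (subst (p ω + 2 <_) (wsum-suc-head 2 a r) p+2<S)

  Pstep-vanishes : ∀ k {rec} → (∀ t → p (suc k) + 2 ≤ bigS t → rec t x ≡ 0ℤ) →
                   p (suc k) < p (suc (suc k)) →
                   ∀ s → p (suc (suc k)) + 2 ≤ bigS s → Pstep (suc k) rec s x ≡ 0ℤ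
  Pstep-vanishes k {rec} rec-0 p<p s hS =
    cong₂ ℤ._+_ (sumℤ-zero (map⁺ (All.map (λ {m} → move-term (proj₁ m) (proj₂ m)) (wsum-moves s))))
                (δterm-vanishes (suc (suc k)) rec-0′ s hS)
    where
    rec-0′ : ∀ t → p (suc (suc k)) < bigS t → rec t x ≡ 0ℤ
    rec-0′ t p<S = rec-0 t (<-<⇒+2≤ p<p p<S)
    move-term : ∀ c t → OneBelow t s → + c ℤ.* rec (∂ t) x ≡ 0ℤ
    move-term c t t⋖s = *-zeroʳ-≡ (+ c) (rec-0′ (∂ t) p<S′)
      where
      p<S′ : p (suc (suc k)) < bigS (∂ t)
      p<S′ rewrite wsum-∂ 2 t = +2≤suc⇒< (subst (p (suc (suc k)) + 2 ≤_) (sym (t⋖s 2)) hS)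

  Pf-vanishes : 1 ≤ p 1 → ∀ m → (∀ k → 1 ≤ k → k < suc m → p k < p (suc k)) →
                ∀ s → p (suc m) + 2 ≤ bigS s → Pf (suc m) s x ≡ 0ℤ
  Pf-vanishes 1≤p₁ zero _ = Pbase-vanishes 1≤p₁
  Pf-vanishes 1≤p₁ (suc k) p-mono =
    Pstep-vanishes k {Pf (suc k)} (Pf-vanishes 1≤p₁ k (λ j 1≤j j<1+k → p-mono j 1≤j (m<n⇒m<1+n j<1+k)))
                     (p-mono (suc k) (s≤s z≤n) ≤-refl)

lemma2p6 : (s : List ℕ) → Dominant s → (N : ℕ) → weight s ≡ N → 2 ≤ N →
    (p : ℕ → ℕ) → 1 ≤ p 1 → (∀ k → 1 ≤ k → k < N → p k < p (suc k)) →
    p N + 2 ≤ bigS s →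
    P s (λ k → + (p k)) ≡ 0ℤ
lemma2p6 s _ (suc m) ω≡N (s≤s _) p 1≤p₁ p-mono hS =
  subst (λ ω → Pf ω s (λ k → + p k) ≡ 0ℤ) (sym ω≡N) (Pf-vanishes p 1≤p₁ m p-mono s hS)
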